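{- Let $B$ be a finite nonempty set in an arbitrary commutative group and let $k$ be a positive integer. Assume that $B$ is $k$-covering. Then for every positive integer $m\geq k$, \[ |(m+1)B|<(14m/k)^k|B|. \]
   Context: $mX$ denotes the $m$-fold iterated sumset $X+\dots+X$. A set $B$ in a group is $k$-covering if there is a set $T$ with $|T|=k$ and $B+B\subseteq B+(T-T)$. -}

module Defs where

open import Level using (Level)
open import Algebra.Bundles using (AbelianGroup)
open import Data.Nat using (ℕ; zero; suc)
open import Data.List using (List; length)
open import Data.Vec using (Vec; []; _∷_)
open import Data.Vec.Relation.Unary.All using (All)
open import Data.Product using (Σ; ∃; _×_)
open import Relation.Binary.PropositionalEquality using (_≡_)
import Data.List.Membership.Setoid as MemS
import Data.List.Relation.Unary.Unique.Setoid as UniqS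

module _ {c ℓ : Level} (G : AbelianGroup c ℓ) where
  open AbelianGroup G

  _∈ᴳ_ : Carrier → List Carrier → Set (c Level.⊔ ℓ)
  x ∈ᴳ xs = MemS._∈_ setoid x xs

  -- a list with no two ≈-equal entries: a finite set with |X| = length X
  Distinct : List Carrier → Set (c Level.⊔ ℓ)
  Distinct xs = UniqS.Unique setoid xs

  vsum : ∀ {n} → Vec Carrier n → Carrier
  vsum []       = ε
  vsum (x ∷ xs) = x ∙ vsum xs

  InSumset : ℕ → List Carrier → Carrier → Set (c Level.⊔ ℓ)
  InSumset m B x = Σ (Vec Carrier m) λ v → All (λ b → b ∈ᴳ B) v × (vsum v ≈ x)

  KCovering : ℕ → List Carrier → Set (c Level.⊔ ℓ)
  KCovering k B =
    Σ (List Carrier) λ T → Distinct T × (length T ≡ k) ×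
      (∀ b₁ b₂ → b₁ ∈ᴳ B → b₂ ∈ᴳ B →
        ∃ λ b → ∃ λ t₁ → ∃ λ t₂ → b ∈ᴳ B × t₁ ∈ᴳ T × t₂ ∈ᴳ T ×
          ((b₁ ∙ b₂) ≈ (b ∙ (t₁ ∙ (t₂ ⁻¹)))))

{-# OPTIONS --safe #-}
module Submission where

-- Iterating B + B ⊆ B + (T − T) gives (m+1)B ⊆ B + m(T − T), and a sum of m differences of
-- elements of T is Σᵢ cᵢtᵢ for an integer vector c with ‖c‖₁ ≤ 2m.  There are at most
-- 2^k·C(2m+k, k) such vectors, so |(m+1)B| ≤ 2^k·C(2m+k, k)·|B|.  Writing
-- k!·C(2m+k, k) = (2m+1)(2m+2)⋯(2m+k), every factor (2m+i)/m decreases in m, so for m ≥ k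
-- this is at most (m/k)^k·k!·C(3k, k), and C(3k, k) < 7^k since consecutive ratios
-- C(3k+3, k+1)/C(3k, k) = 3(3k+1)(3k+2)/((2k+1)(2k+2)) stay below 7.

open import Defs
open import Level using (Level; _⊔_)
open import Algebra.Bundles using (AbelianGroup)
open import Data.Nat using (ℕ; zero; suc; _+_; _*_; _^_; _!; _≤_; _<_; s≤s; z<s; s<s)
open import Data.Nat.Properties
open import Data.Nat.Tactic.RingSolver using (solve-∀)
open import Algebra.Properties.CommutativeSemigroup *-commutativeSemigroup
  using (interchange; x∙yz≈y∙xz; x∙yz≈yx∙z; xy∙z≈xz∙y)
open import Data.Integer using (ℤ; 0ℤ; -[1+_]; ∣_∣; _◃_; sign; 1ℤ; -1ℤ)
import Data.Integer as ℤ
open import Data.Integer.Properties using (◃-inverse; ∣i+j∣≤∣i∣+∣j∣)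
open import Data.Sign using (Sign)
open import Data.Fin using (Fin; zero; suc)
open import Data.Fin.Properties using (injective⇒≤)
open import Data.List using (List; []; _∷_; [_]; _++_; map; length; lookup; cartesianProductWith)
open import Data.List.Properties using (length-++; length-map)
open import Data.List.Relation.Unary.Any using (here; there; index)
open import Data.List.Relation.Unary.Any.Properties using (lookup-index)
import Data.List.Relation.Unary.Any.Properties as Any
import Data.List.Relation.Unary.All as All
open import Data.List.Relation.Unary.AllPairs using (_∷_)
open import Data.List.Membership.Propositional.Properties
  using (∈-map⁺; ∈-++⁺ˡ; ∈-++⁺ʳ; ∈-cartesianProductWith⁺) renaming (∈-lookup to ∈ₚ-lookup)
import Data.List.Membership.Setoid.Properties as Membershipₛ
open import Data.Vec using (Vec; []; _∷_; sum; zipWith; updateAt; replicate) renaming (map to vmap)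
open import Data.Vec.Relation.Unary.All using ([]; _∷_)
open import Data.Product using (∃; ∃₂; _×_; _,_)
open import Data.Empty using (⊥-elim)
open import Relation.Binary.Bundles using (Setoid)
open import Relation.Binary.PropositionalEquality
  using (_≡_; _≢_; refl; sym; trans; cong; cong₂; subst; module ≡-Reasoning)

length-cartesianProductWith : ∀ {a b c} {A : Set a} {B : Set b} {C : Set c} (f : A → B → C) xs ys →
                              length (cartesianProductWith f xs ys) ≡ length xs * length ys
length-cartesianProductWith f []       ys = refl
length-cartesianProductWith f (x ∷ xs) ys = begin
  length (map (f x) ys ++ cartesianProductWith f xs ys)         ≡⟨ length-++ (map (f x) ys) ⟩
  length (map (f x) ys) + length (cartesianProductWith f xs ys)
    ≡⟨ cong₂ _+_ (length-map (f x) ys) (length-cartesianProductWith f xs ys) ⟩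
  length ys + length xs * length ys                             ∎
  where open ≡-Reasoning

module _ {a ℓ : Level} (S : Setoid a ℓ) where

  open Setoid S using (_≈_) renaming (sym to ≈-sym)
  open import Data.List.Relation.Binary.Subset.Setoid S using (_⊆_)
  open import Data.List.Relation.Unary.Unique.Setoid S using (Unique)

  Unique-lookup-injective : ∀ {xs} → Unique xs → ∀ i j → lookup xs i ≈ lookup xs j → i ≡ j
  Unique-lookup-injective {_ ∷ _} _             zero    zero    _ = refl
  Unique-lookup-injective         (x≉xs ∷ _)    zero    (suc j) e = ⊥-elim (All.lookup x≉xs (∈ₚ-lookup j) e)
  Unique-lookup-injective         (x≉xs ∷ _)    (suc i) zero    e = ⊥-elim (All.lookup x≉xs (∈ₚ-lookup i) (≈-sym e))
  Unique-lookup-injective         (_ ∷ xs-uniq) (suc i) (suc j) e = cong suc (Unique-lookup-injective xs-uniq i j e)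

  Unique-⊆⇒length-≤ : ∀ {xs ys} → Unique xs → xs ⊆ ys → length xs ≤ length ys
  Unique-⊆⇒length-≤ {xs} {ys} xs-uniq xs⊆ys = injective⇒≤ position-injective
    where
    open import Relation.Binary.Reasoning.Setoid S
    position : Fin (length xs) → Fin (length ys)
    position i = index (xs⊆ys (Membershipₛ.∈-lookup S xs i))
    position-injective : ∀ {i j} → position i ≡ position j → i ≡ j
    position-injective {i} {j} eq = Unique-lookup-injective xs-uniq i j (begin
      lookup xs i            ≈⟨ lookup-index (xs⊆ys (Membershipₛ.∈-lookup S xs i)) ⟩
      lookup ys (position i) ≡⟨ cong (lookup ys) eq ⟩
      lookup ys (position j) ≈⟨ lookup-index (xs⊆ys (Membershipₛ.∈-lookup S xs j)) ⟨
      lookup xs j            ∎)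

rising : ℕ → ℕ → ℕ
rising x zero    = 1
rising x (suc k) = (x + k) * rising x k

rising-shift : ∀ x k → x * rising (suc x) k ≡ (x + k) * rising x k
rising-shift x zero    = cong (_* 1) (sym (+-identityʳ x))
rising-shift x (suc k) = begin
  x * ((suc x + k) * rising (suc x) k) ≡⟨ x∙yz≈y∙xz x (suc x + k) _ ⟩
  (suc x + k) * (x * rising (suc x) k) ≡⟨ cong₂ _*_ (sym (+-suc x k)) (rising-shift x k) ⟩
  (x + suc k) * ((x + k) * rising x k) ∎
  where open ≡-Reasoning

rising-shift₂ : ∀ x k → x * suc x * rising (2 + x) k ≡ (x + k) * (suc x + k) * rising x k
rising-shift₂ x k = begin
  x * suc x * rising (2 + x) k         ≡⟨ *-assoc x (suc x) _ ⟩
  x * (suc x * rising (2 + x) k)       ≡⟨ cong (x *_) (rising-shift (suc x) k) ⟩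
  x * ((suc x + k) * rising (suc x) k) ≡⟨ x∙yz≈y∙xz x (suc x + k) _ ⟩
  (suc x + k) * (x * rising (suc x) k) ≡⟨ cong ((suc x + k) *_) (rising-shift x k) ⟩
  (suc x + k) * ((x + k) * rising x k) ≡⟨ x∙yz≈yx∙z (suc x + k) (x + k) _ ⟩
  (x + k) * (suc x + k) * rising x k   ∎
  where open ≡-Reasoning

k^j*rising[1+cm]≤m^j*rising[1+ck] : ∀ c j {k m} → k ≤ m →
                                    k ^ j * rising (suc (c * m)) j ≤ m ^ j * rising (suc (c * k)) j
k^j*rising[1+cm]≤m^j*rising[1+ck] c zero    k≤m = ≤-refl
k^j*rising[1+cm]≤m^j*rising[1+ck] c (suc j) {k} {m} k≤m = begin
  k * k ^ j * ((suc (c * m) + j) * rising (suc (c * m)) j)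
    ≡⟨ interchange k (k ^ j) (suc (c * m) + j) _ ⟩
  k * (suc (c * m) + j) * (k ^ j * rising (suc (c * m)) j)
    ≤⟨ *-mono-≤ factor (k^j*rising[1+cm]≤m^j*rising[1+ck] c j k≤m) ⟩
  m * (suc (c * k) + j) * (m ^ j * rising (suc (c * k)) j)
    ≡⟨ interchange m (suc (c * k) + j) (m ^ j) _ ⟩
  m * m ^ j * ((suc (c * k) + j) * rising (suc (c * k)) j) ∎
  where
  open ≤-Reasoning
  expand : ∀ c j a b → a * (suc (c * b) + j) ≡ c * a * b + a * suc j
  expand = solve-∀
  factor : k * (suc (c * m) + j) ≤ m * (suc (c * k) + j)
  factor = begin
    k * (suc (c * m) + j)  ≡⟨ expand c j k m ⟩
    c * k * m + k * suc j  ≤⟨ +-monoʳ-≤ (c * k * m) (*-monoˡ-≤ (suc j) k≤m) ⟩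
    c * k * m + m * suc j  ≡⟨ cong (_+ m * suc j) (xy∙z≈xz∙y c k m) ⟩
    c * m * k + m * suc j  ≡⟨ sym (expand c j m k) ⟩
    m * (suc (c * k) + j)  ∎

-- Multiplying by (2k+1)(2k+2) turns this into (3k+1)(3k+2)(3k+3) ≤ 7(k+1)(2k+1)(2k+2),
-- whose slack is (k+1)(k²+15k+8).
rising[1+2k]k-step : ∀ k → rising (suc (2 * suc k)) (suc k) ≤ 7 * suc k * rising (suc (2 * k)) k
rising[1+2k]k-step k = *-cancelˡ-≤ (x * suc x) (begin
  x * suc x * rising (suc (2 * suc k)) (suc k)
    ≡⟨ cong (λ y → x * suc x * rising (suc y) (suc k)) (*-suc 2 k) ⟩
  x * suc x * ((2 + x + k) * rising (2 + x) k)
    ≡⟨ x∙yz≈y∙xz (x * suc x) (2 + x + k) (rising (2 + x) k) ⟩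
  (2 + x + k) * (x * suc x * rising (2 + x) k)
    ≡⟨ cong ((2 + x + k) *_) (rising-shift₂ x k) ⟩
  (2 + x + k) * ((x + k) * (suc x + k) * rising x k)
    ≤⟨ m≤m+n _ _ ⟩
  (2 + x + k) * ((x + k) * (suc x + k) * rising x k) + suc k * (k * k + 15 * k + 8) * rising x k
    ≡⟨ slack k (rising x k) ⟩
  x * suc x * (7 * suc k * rising x k) ∎)
  where
  open ≤-Reasoning
  x = suc (2 * k)
  slack : ∀ k r → (3 + 2 * k + k) * ((suc (2 * k) + k) * (2 + 2 * k + k) * r) + suc k * (k * k + 15 * k + 8) * r
                ≡ suc (2 * k) * (2 + 2 * k) * (7 * suc k * r)
  slack = solve-∀

rising[1+2k]k<7^k*k! : ∀ k → rising (suc (2 * suc k)) (suc k) < 7 ^ suc k * suc k !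
rising[1+2k]k<7^k*k! zero    = s<s (s<s (s<s z<s))
rising[1+2k]k<7^k*k! (suc k) = begin-strict
  rising (suc (2 * suc (suc k))) (suc (suc k))        ≤⟨ rising[1+2k]k-step (suc k) ⟩
  7 * suc (suc k) * rising (suc (2 * suc k)) (suc k) <⟨ *-monoʳ-< (7 * suc (suc k)) (rising[1+2k]k<7^k*k! k) ⟩
  7 * suc (suc k) * (7 ^ suc k * suc k !)            ≡⟨ interchange 7 (suc (suc k)) (7 ^ suc k) (suc k !) ⟩
  7 ^ suc (suc k) * suc (suc k) !                    ∎
  where open ≤-Reasoning

^-distribʳ-* : ∀ a b n → (a * b) ^ n ≡ a ^ n * b ^ n
^-distribʳ-* a b zero    = refl
^-distribʳ-* a b (suc n) = trans (cong (a * b *_) (^-distribʳ-* a b n)) (interchange a b (a ^ n) (b ^ n))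

k^k*2^k*rising<[14m]^k*k! : ∀ {k m} → 1 ≤ k → k ≤ m →
                            k ^ k * (2 ^ k * rising (suc (2 * m)) k) < (14 * m) ^ k * k !
k^k*2^k*rising<[14m]^k*k! {suc k} {suc m} _ k≤m = begin-strict
  K ^ K * (2 ^ K * rising (suc (2 * M)) K) ≡⟨ x∙yz≈y∙xz (K ^ K) (2 ^ K) _ ⟩
  2 ^ K * (K ^ K * rising (suc (2 * M)) K) ≤⟨ *-monoʳ-≤ (2 ^ K) (k^j*rising[1+cm]≤m^j*rising[1+ck] 2 K k≤m) ⟩
  2 ^ K * (M ^ K * rising (suc (2 * K)) K)
    <⟨ *-monoʳ-< (2 ^ K) {{m^n≢0 2 K}} (*-monoʳ-< (M ^ K) {{m^n≢0 M K}} (rising[1+2k]k<7^k*k! k)) ⟩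
  2 ^ K * (M ^ K * (7 ^ K * K !))           ≡⟨ regroup (2 ^ K) (M ^ K) (7 ^ K) (K !) ⟩
  2 ^ K * 7 ^ K * M ^ K * K !               ≡⟨ cong (λ p → p * M ^ K * K !) (sym (^-distribʳ-* 2 7 K)) ⟩
  14 ^ K * M ^ K * K !                      ≡⟨ cong (_* K !) (sym (^-distribʳ-* 14 M K)) ⟩
  (14 * M) ^ K * K !                        ∎
  where
  open ≤-Reasoning
  K = suc k
  M = suc m
  regroup : ∀ a b c d → a * (b * (c * d)) ≡ a * c * b * d
  regroup = solve-∀

module LatticePoints where

  open import Data.List.Membership.Propositional using (_∈_)

  vectorsOver : ∀ {a} {A : Set a} → List A → ∀ n → List (Vec A n)
  vectorsOver xs zero    = [ [] ]
  vectorsOver xs (suc n) = cartesianProductWith _∷_ xs (vectorsOver xs n)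

  length-vectorsOver : ∀ {a} {A : Set a} (xs : List A) n → length (vectorsOver xs n) ≡ length xs ^ n
  length-vectorsOver xs zero    = refl
  length-vectorsOver xs (suc n) = trans (length-cartesianProductWith _∷_ xs (vectorsOver xs n))
                                        (cong (length xs *_) (length-vectorsOver xs n))

  ∈-vectorsOver : ∀ {a} {A : Set a} {xs : List A} → (∀ x → x ∈ xs) → ∀ {n} (v : Vec A n) → v ∈ vectorsOver xs n
  ∈-vectorsOver complete []      = here refl
  ∈-vectorsOver complete (x ∷ v) = ∈-cartesianProductWith⁺ _∷_ (complete x) (∈-vectorsOver complete v)

  incrementHead : ∀ {n} → Vec ℕ (suc n) → Vec ℕ (suc n)
  incrementHead (a ∷ u) = suc a ∷ u

  boundedVecs : ∀ n (r : ℕ) → List (Vec ℕ n)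
  boundedVecs zero    r       = [ [] ]
  boundedVecs (suc n) zero    = map (0 ∷_) (boundedVecs n zero)
  boundedVecs (suc n) (suc r) = map (0 ∷_) (boundedVecs n (suc r)) ++ map incrementHead (boundedVecs (suc n) r)

  ∈-boundedVecs : ∀ {n r} (u : Vec ℕ n) → sum u ≤ r → u ∈ boundedVecs n r
  ∈-boundedVecs             []          _          = here refl
  ∈-boundedVecs {r = zero}  (zero ∷ u)  Σu≤r       = ∈-map⁺ (0 ∷_) (∈-boundedVecs u Σu≤r)
  ∈-boundedVecs {r = suc r} (zero ∷ u)  Σu≤r       = ∈-++⁺ˡ (∈-map⁺ (0 ∷_) (∈-boundedVecs u Σu≤r))
  ∈-boundedVecs {r = suc r} (suc a ∷ u) (s≤s Σu≤r) =
    ∈-++⁺ʳ (map (0 ∷_) (boundedVecs _ (suc r))) (∈-map⁺ incrementHead (∈-boundedVecs (a ∷ u) Σu≤r))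

  length-boundedVecs : ∀ n r → n ! * length (boundedVecs n r) ≡ rising (suc r) n
  length-boundedVecs zero    r       = refl
  length-boundedVecs (suc n) zero    = begin
    suc n * n ! * length (map (0 ∷_) (boundedVecs n zero))
      ≡⟨ cong (suc n * n ! *_) (length-map (0 ∷_) (boundedVecs n zero)) ⟩
    suc n * n ! * length (boundedVecs n zero)  ≡⟨ *-assoc (suc n) (n !) _ ⟩
    suc n * (n ! * length (boundedVecs n zero)) ≡⟨ cong (suc n *_) (length-boundedVecs n zero) ⟩
    suc n * rising 1 n                         ∎
    where open ≡-Reasoning
  length-boundedVecs (suc n) (suc r) = begin
    suc n ! * length (map (0 ∷_) (boundedVecs n (suc r)) ++ map incrementHead (boundedVecs (suc n) r))
      ≡⟨ cong (suc n ! *_) (trans (length-++ (map (0 ∷_) (boundedVecs n (suc r))))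
                                  (cong₂ _+_ (length-map (0 ∷_) (boundedVecs n (suc r)))
                                             (length-map incrementHead (boundedVecs (suc n) r)))) ⟩
    suc n * n ! * (length (boundedVecs n (suc r)) + length (boundedVecs (suc n) r))
      ≡⟨ split (suc n) (n !) _ _ ⟩
    suc n * (n ! * length (boundedVecs n (suc r))) + suc n ! * length (boundedVecs (suc n) r)
      ≡⟨ cong₂ _+_ (cong (suc n *_) (length-boundedVecs n (suc r))) (length-boundedVecs (suc n) r) ⟩
    suc n * rising (2 + r) n + (suc r + n) * rising (suc r) n
      ≡⟨ cong (suc n * rising (2 + r) n +_) (sym (rising-shift (suc r) n)) ⟩
    suc n * rising (2 + r) n + suc r * rising (2 + r) n
      ≡⟨ collect n r (rising (2 + r) n) ⟩
    (2 + r + n) * rising (2 + r) n ∎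
    where
    open ≡-Reasoning
    split : ∀ a b x y → a * b * (x + y) ≡ a * (b * x) + a * b * y
    split = solve-∀
    collect : ∀ n r x → suc n * x + suc r * x ≡ (suc (suc r) + n) * x
    collect = solve-∀

  signs : List Sign
  signs = Sign.+ ∷ Sign.- ∷ []

  ∈-signs : ∀ s → s ∈ signs
  ∈-signs Sign.+ = here refl
  ∈-signs Sign.- = there (here refl)

  ℓ₁ : ∀ {n} → Vec ℤ n → ℕ
  ℓ₁ c = sum (vmap ∣_∣ c)

  ℓ₁-replicate-0 : ∀ n → ℓ₁ (replicate n 0ℤ) ≡ 0
  ℓ₁-replicate-0 zero    = refl
  ℓ₁-replicate-0 (suc n) = ℓ₁-replicate-0 n

  ℓ₁-updateAt : ∀ {n} {f : ℤ → ℤ} → (∀ z → ∣ f z ∣ ≤ suc ∣ z ∣) →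
                ∀ (c : Vec ℤ n) i → ℓ₁ (updateAt c i f) ≤ suc (ℓ₁ c)
  ℓ₁-updateAt ∣f∣≤ (z ∷ c) zero    = +-monoˡ-≤ (ℓ₁ c) (∣f∣≤ z)
  ℓ₁-updateAt ∣f∣≤ (z ∷ c) (suc i) = begin
    ∣ z ∣ + ℓ₁ (updateAt c i _) ≤⟨ +-monoʳ-≤ ∣ z ∣ (ℓ₁-updateAt ∣f∣≤ c i) ⟩
    ∣ z ∣ + suc (ℓ₁ c)          ≡⟨ +-suc ∣ z ∣ (ℓ₁ c) ⟩
    suc (∣ z ∣ + ℓ₁ c)          ∎
    where open ≤-Reasoning

  ℓ₁-updateAt-suc-pred : ∀ {n} (c : Vec ℤ n) i j → ℓ₁ (updateAt (updateAt c j ℤ.pred) i ℤ.suc) ≤ 2 + ℓ₁ c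
  ℓ₁-updateAt-suc-pred c i j = begin
    ℓ₁ (updateAt (updateAt c j ℤ.pred) i ℤ.suc) ≤⟨ ℓ₁-updateAt (∣i+j∣≤∣i∣+∣j∣ 1ℤ) (updateAt c j ℤ.pred) i ⟩
    suc (ℓ₁ (updateAt c j ℤ.pred))              ≤⟨ s≤s (ℓ₁-updateAt (∣i+j∣≤∣i∣+∣j∣ -1ℤ) c j) ⟩
    2 + ℓ₁ c                                    ∎
    where open ≤-Reasoning

  -- Lists each point once per choice of signs for its zero entries.
  ℓ₁-ball : ∀ n r → List (Vec ℤ n)
  ℓ₁-ball n r = cartesianProductWith (zipWith _◃_) (vectorsOver signs n) (boundedVecs n r)

  length-ℓ₁-ball : ∀ n r → length (ℓ₁-ball n r) ≡ 2 ^ n * length (boundedVecs n r)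
  length-ℓ₁-ball n r = trans (length-cartesianProductWith (zipWith _◃_) (vectorsOver signs n) (boundedVecs n r))
                             (cong (_* length (boundedVecs n r)) (length-vectorsOver signs n))

  zipWith-◃-sign-abs : ∀ {n} (c : Vec ℤ n) → zipWith _◃_ (vmap sign c) (vmap ∣_∣ c) ≡ c
  zipWith-◃-sign-abs []      = refl
  zipWith-◃-sign-abs (z ∷ c) = cong₂ _∷_ (◃-inverse z) (zipWith-◃-sign-abs c)

  ∈-ℓ₁-ball : ∀ {n r} (c : Vec ℤ n) → ℓ₁ c ≤ r → c ∈ ℓ₁-ball n r
  ∈-ℓ₁-ball c ℓ₁c≤r = subst (_∈ _) (zipWith-◃-sign-abs c)
    (∈-cartesianProductWith⁺ (zipWith _◃_) (∈-vectorsOver ∈-signs (vmap sign c)) (∈-boundedVecs (vmap ∣_∣ c) ℓ₁c≤r))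

  k^k*|ℓ₁-ball|<[14m]^k : ∀ {k m} → 1 ≤ k → k ≤ m → k ^ k * length (ℓ₁-ball k (2 * m)) < (14 * m) ^ k
  k^k*|ℓ₁-ball|<[14m]^k {k} {m} 1≤k k≤m = *-cancelˡ-< (k !) _ _ (begin-strict
    k ! * (k ^ k * length (ℓ₁-ball k (2 * m)))
      ≡⟨ cong (λ l → k ! * (k ^ k * l)) (length-ℓ₁-ball k (2 * m)) ⟩
    k ! * (k ^ k * (2 ^ k * length U))   ≡⟨ regroup (k !) (k ^ k) (2 ^ k) (length U) ⟩
    k ^ k * (2 ^ k * (k ! * length U))   ≡⟨ cong (λ l → k ^ k * (2 ^ k * l)) (length-boundedVecs k (2 * m)) ⟩
    k ^ k * (2 ^ k * rising (suc (2 * m)) k) <⟨ k^k*2^k*rising<[14m]^k*k! 1≤k k≤m ⟩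
    (14 * m) ^ k * k !                   ≡⟨ *-comm ((14 * m) ^ k) (k !) ⟩
    k ! * (14 * m) ^ k                   ∎)
    where
    open ≤-Reasoning
    U = boundedVecs k (2 * m)
    regroup : ∀ a b c d → a * (b * (c * d)) ≡ b * (c * (a * d))
    regroup = solve-∀

open LatticePoints using (ℓ₁; ℓ₁-replicate-0; ℓ₁-updateAt-suc-pred; ℓ₁-ball; ∈-ℓ₁-ball; k^k*|ℓ₁-ball|<[14m]^k)

module _ {c ℓ : Level} (G : AbelianGroup c ℓ) where

  open AbelianGroup G renaming (refl to ≈-refl; sym to ≈-sym; trans to ≈-trans)
  open import Algebra.Definitions.RawMonoid rawMonoid using () renaming (_×_ to _·ℕ_)
  open import Algebra.Properties.Group group using (\\-leftDividesˡ; \\-leftDividesʳ; //-cong₂)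
  import Algebra.Properties.CommutativeSemigroup commutativeSemigroup as ∙-Properties
  open import Data.List.Membership.Setoid setoid using (_∈_)
  open import Relation.Binary.Reasoning.Setoid setoid

  infixr 8 _·_
  _·_ : ℤ → Carrier → Carrier
  (ℤ.+ n)  · t = n ·ℕ t
  -[1+ n ] · t = suc n ·ℕ (t ⁻¹)

  ·-suc : ∀ z t → ℤ.suc z · t ≈ t ∙ z · t
  ·-suc (ℤ.+ n)        t = ≈-refl
  ·-suc -[1+ zero ]    t = ≈-sym (\\-leftDividesˡ t ε)
  ·-suc -[1+ suc n ]   t = ≈-sym (\\-leftDividesˡ t _)

  ·-pred : ∀ z t → ℤ.pred z · t ≈ t ⁻¹ ∙ z · t
  ·-pred -[1+ n ]      t = ≈-refl
  ·-pred (ℤ.+ zero)    t = ≈-refl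
  ·-pred (ℤ.+ suc n)   t = ≈-sym (\\-leftDividesʳ t _)

  lin : (ts : List Carrier) → Vec ℤ (length ts) → Carrier
  lin []       []      = ε
  lin (t ∷ ts) (z ∷ c) = z · t ∙ lin ts c

  lin-zero : ∀ ts → lin ts (replicate (length ts) 0ℤ) ≈ ε
  lin-zero []       = ≈-refl
  lin-zero (t ∷ ts) = ≈-trans (identityˡ _) (lin-zero ts)

  lin-updateAt : ∀ {f : ℤ → ℤ} {g : Carrier → Carrier} → (∀ z t → f z · t ≈ g t ∙ z · t) →
                 ∀ ts c (i : Fin (length ts)) → lin ts (updateAt c i f) ≈ g (lookup ts i) ∙ lin ts c
  lin-updateAt {f} {g} f·≈g∙ (t ∷ ts) (z ∷ c) zero = begin
    f z · t ∙ lin ts c       ≈⟨ ∙-congʳ (f·≈g∙ z t) ⟩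
    (g t ∙ z · t) ∙ lin ts c ≈⟨ assoc (g t) (z · t) (lin ts c) ⟩
    g t ∙ (z · t ∙ lin ts c) ∎
  lin-updateAt {f} {g} f·≈g∙ (t ∷ ts) (z ∷ c) (suc i) = begin
    z · t ∙ lin ts (updateAt c i f)      ≈⟨ ∙-congˡ (lin-updateAt f·≈g∙ ts c i) ⟩
    z · t ∙ (g (lookup ts i) ∙ lin ts c) ≈⟨ ∙-Properties.x∙yz≈y∙xz (z · t) _ _ ⟩
    g (lookup ts i) ∙ (z · t ∙ lin ts c) ∎

  Covers : List Carrier → List Carrier → Set (c ⊔ ℓ)
  Covers D B = ∀ {b₁ b₂} → b₁ ∈ B → b₂ ∈ B → ∃₂ λ b d → b ∈ B × d ∈ D × b₁ ∙ b₂ ≈ b ∙ d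

  [1+m]B⊆B+mD : ∀ {B D} → Covers D B → ∀ m {x} → InSumset G (suc m) B x →
                ∃₂ λ b y → b ∈ B × InSumset G m D y × x ≈ b ∙ y
  [1+m]B⊆B+mD _ zero (b ∷ [] , b∈B ∷ [] , b∙ε≈x) = b , ε , b∈B , ([] , [] , ≈-refl) , ≈-sym b∙ε≈x
  [1+m]B⊆B+mD D-covers (suc m) {x} (b₁ ∷ v , b₁∈B ∷ v⊆B , b₁∙Σv≈x)
    with b , y , b∈B , (w , w⊆D , Σw≈y) , Σv≈b∙y ← [1+m]B⊆B+mD D-covers m (v , v⊆B , ≈-refl)
    with b′ , d , b′∈B , d∈D , b₁∙b≈b′∙d ← D-covers b₁∈B b∈B
    = b′ , d ∙ y , b′∈B , (d ∷ w , d∈D ∷ w⊆D , ∙-congˡ Σw≈y) , (begin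
      x                ≈⟨ b₁∙Σv≈x ⟨
      b₁ ∙ vsum G v    ≈⟨ ∙-congˡ Σv≈b∙y ⟩
      b₁ ∙ (b ∙ y)     ≈⟨ assoc b₁ b y ⟨
      (b₁ ∙ b) ∙ y     ≈⟨ ∙-congʳ b₁∙b≈b′∙d ⟩
      (b′ ∙ d) ∙ y     ≈⟨ assoc b′ d y ⟩
      b′ ∙ (d ∙ y)     ∎)

  differences : List Carrier → List Carrier
  differences T = cartesianProductWith _-_ T T

  KCovering⇒Covers : ∀ {k B} → KCovering G k B → ∃ λ T → length T ≡ k × Covers (differences T) B
  KCovering⇒Covers (T , _ , |T|≡k , covers) = T , |T|≡k , λ b₁∈B b₂∈B →
    let b , t₁ , t₂ , b∈B , t₁∈T , t₂∈T , b₁∙b₂≈b∙[t₁-t₂] = covers _ _ b₁∈B b₂∈B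
    in b , t₁ - t₂ , b∈B , Membershipₛ.∈-cartesianProductWith⁺ setoid setoid setoid //-cong₂ t₁∈T t₂∈T
         , b₁∙b₂≈b∙[t₁-t₂]

  m[T-T]⊆lin[ℓ₁≤2m] : ∀ T m {y} → InSumset G m (differences T) y → ∃ λ c → ℓ₁ c ≤ 2 * m × y ≈ lin T c
  m[T-T]⊆lin[ℓ₁≤2m] T zero ([] , [] , ε≈y) =
    replicate (length T) 0ℤ , ≤-reflexive (ℓ₁-replicate-0 (length T)) , ≈-trans (≈-sym ε≈y) (≈-sym (lin-zero T))
  m[T-T]⊆lin[ℓ₁≤2m] T (suc m) {y} (d ∷ w , d∈T-T ∷ w⊆T-T , d∙Σw≈y)
    with c , ℓ₁c≤2m , Σw≈c ← m[T-T]⊆lin[ℓ₁≤2m] T m (w , w⊆T-T , ≈-refl)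
       | t , t′ , t∈T , t′∈T , d≈t-t′ ← Membershipₛ.∈-cartesianProductWith⁻ setoid setoid setoid _-_ T T d∈T-T
    = updateAt (updateAt c j ℤ.pred) i ℤ.suc , ℓ₁-bound , (begin
      y                                       ≈⟨ d∙Σw≈y ⟨
      d ∙ vsum G w                            ≈⟨ ∙-cong d≈t-t′ Σw≈c ⟩
      (t ∙ t′ ⁻¹) ∙ lin T c                   ≈⟨ assoc t (t′ ⁻¹) (lin T c) ⟩
      t ∙ (t′ ⁻¹ ∙ lin T c)                   ≈⟨ ∙-cong (lookup-index t∈T) (∙-congʳ (⁻¹-cong (lookup-index t′∈T))) ⟩
      lookup T i ∙ (lookup T j ⁻¹ ∙ lin T c)  ≈⟨ ∙-congˡ (lin-updateAt ·-pred T c j) ⟨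
      lookup T i ∙ lin T (updateAt c j ℤ.pred) ≈⟨ lin-updateAt ·-suc T (updateAt c j ℤ.pred) i ⟨
      lin T (updateAt (updateAt c j ℤ.pred) i ℤ.suc) ∎)
    where
    i = index t∈T
    j = index t′∈T
    ℓ₁-bound : ℓ₁ (updateAt (updateAt c j ℤ.pred) i ℤ.suc) ≤ 2 * suc m
    ℓ₁-bound = ≤-trans (ℓ₁-updateAt-suc-pred c i j)
                       (≤-trans (+-monoʳ-≤ 2 ℓ₁c≤2m) (≤-reflexive (sym (*-suc 2 m))))

  B+ℓ₁-ball : List Carrier → List Carrier → ℕ → List Carrier
  B+ℓ₁-ball B T r = cartesianProductWith (λ b c → b ∙ lin T c) B (ℓ₁-ball (length T) r)

  length-B+ℓ₁-ball : ∀ B T r → length (B+ℓ₁-ball B T r) ≡ length B * length (ℓ₁-ball (length T) r)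
  length-B+ℓ₁-ball B T r = length-cartesianProductWith (λ b c → b ∙ lin T c) B (ℓ₁-ball (length T) r)

  [1+m]B⊆B+ℓ₁-ball : ∀ {B} T → Covers (differences T) B → ∀ m {x} →
                     InSumset G (suc m) B x → x ∈ B+ℓ₁-ball B T (2 * m)
  [1+m]B⊆B+ℓ₁-ball T T-T-covers m x∈[1+m]B
    with b , y , b∈B , y∈m[T-T] , x≈b∙y ← [1+m]B⊆B+mD T-T-covers m x∈[1+m]B
    with c , ℓ₁c≤2m , y≈c ← m[T-T]⊆lin[ℓ₁≤2m] T m y∈m[T-T]
    = Any.cartesianProductWith⁺ (λ b c → b ∙ lin T c) (λ { b≈b′ refl → ≈-trans x≈b∙y (∙-cong b≈b′ y≈c) })
                                b∈B (∈-ℓ₁-ball c ℓ₁c≤2m)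

mainTheorem9 : ∀ {c ℓ} (G : AbelianGroup c ℓ) (B : List (AbelianGroup.Carrier G)) →
    B ≢ [] → Distinct G B →
    (k : ℕ) → 1 ≤ k → KCovering G k B →
    (m : ℕ) → k ≤ m →
    (S : List (AbelianGroup.Carrier G)) → Distinct G S →
    (∀ x → _∈ᴳ_ G x S → InSumset G (suc m) B x) →
    k ^ k * length S < (14 * m) ^ k * length B
mainTheorem9 G []          B≢[] _ _ _   _          _ _   _ _          _         = ⊥-elim (B≢[] refl)
mainTheorem9 G B@(_ ∷ _)   _    _ k 1≤k k-covering m k≤m S S-distinct S⊆[1+m]B
  with T , refl , T-T-covers ← KCovering⇒Covers G k-covering = begin-strict
  k ^ k * length S                                ≤⟨ *-monoʳ-≤ (k ^ k) |S|≤|B+ℓ₁-ball| ⟩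
  k ^ k * length (B+ℓ₁-ball G B T (2 * m))        ≡⟨ cong (k ^ k *_) (length-B+ℓ₁-ball G B T (2 * m)) ⟩
  k ^ k * (length B * length (ℓ₁-ball k (2 * m))) ≡⟨ x∙yz≈y∙xz (k ^ k) (length B) _ ⟩
  length B * (k ^ k * length (ℓ₁-ball k (2 * m))) <⟨ *-monoʳ-< (length B) (k^k*|ℓ₁-ball|<[14m]^k 1≤k k≤m) ⟩
  length B * (14 * m) ^ k                         ≡⟨ *-comm (length B) _ ⟩
  (14 * m) ^ k * length B                         ∎
  where
  open ≤-Reasoning
  |S|≤|B+ℓ₁-ball| : length S ≤ length (B+ℓ₁-ball G B T (2 * m))
  |S|≤|B+ℓ₁-ball| = Unique-⊆⇒length-≤ (AbelianGroup.setoid G) S-distinct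
    (λ {x} x∈S → [1+m]B⊆B+ℓ₁-ball G T T-T-covers m (S⊆[1+m]B x x∈S))
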